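{- Let $\mathcal H$ be a nice operator. For each operator form $\varphi(x,X)$ there is $n\prec\omega$ such that $\mathcal H\vdash^{\Omega+\omega\cdot n}_0\forall x\in\mathbb N\,\big(\varphi(x,I^{\prec\Omega}_\varphi)\to I^{\prec\Omega}_\varphi x\big)$.
   Context: Ordinal terms: The set $\vartheta(\varepsilon_{\Omega+1})$ of terms, a relation $\prec$ and finite sets $E(\alpha)$ are defined by simultaneous recursion on term length: Terms: $\Omega$; $\vartheta\alpha$ for each term $\alpha$; $\langle\alpha_0,\dots,\alpha_{n-1}\rangle$ ($n\ge0$) provided that if $n>1$ then $\alpha_{n-1}\preceq\dots\preceq\alpha_0$ ($\preceq$ is $\prec$ or syntactic equality), and if $n=1$ then $\alpha_0$ is not $\Omega$ or of the form $\vartheta\beta$. $E(\Omega)=\emptyset$, $E(\vartheta\alpha)=\{\vartheta\alpha\}$, $E(\langle\alpha_0,\dots\rangle)=\bigcup_iE(\alpha_i)$. $\alpha\prec\beta$ iff: (1) $\alpha=\Omega$, $\beta=\langle\beta_0,\dots,\beta_{n-1}\rangle$, $n>0$, $\Omega\preceq\beta_0$; or (2) $\alpha=\vartheta\alpha'$ and either $\beta=\Omega$, or $\beta=\langle\beta_0,\dots\rangle$ nonempty with $\alpha\preceq\beta_0$, or $\beta=\vartheta\beta'$ with $\alpha'\prec\beta'$ and $\gamma\prec\beta$ for all $\gamma\in E(\alpha')$, or $\beta=\vartheta\beta'$ with $\alpha\preceq\gamma$ for some $\gamma\in E(\beta')$; or (3) $\alpha=\langle\alpha_0,\dots,\alpha_{m-1}\rangle$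 and either $\beta\in\{\Omega\}\cup\{\vartheta\beta'\}$ with ($m=0$ or $\alpha_0\prec\beta$), or $\beta=\langle\beta_0,\dots,\beta_{n-1}\rangle$ is lexicographically larger ($\alpha$ a proper initial segment of $\beta$, or first difference $\alpha_j\prec\beta_j$). Numerals: $n:=\langle0,\dots,0\rangle$ ($n$ entries, $0=\langle\rangle$), $\omega:=\langle 1\rangle$. Addition: identify $\Omega,\vartheta\alpha$ with $\langle\Omega\rangle,\langle\vartheta\alpha\rangle$ and set $\langle\alpha_0,\dots,\alpha_{m-1}\rangle+\langle\beta_0,\dots,\beta_{n-1}\rangle=\langle\alpha_0,\dots,\alpha_{k-1},\beta_0,\dots,\beta_{n-1}\rangle$ where $k$ is largest such that $\beta_0\preceq\alpha_{k-1}$ (all of $\alpha$ if $n=0$; $k=0$ if no such); $\omega\cdot\Omega=\Omega$, $\omega\cdot\vartheta\alpha=\vartheta\alpha$, $\omega\cdot\langle\alpha_0,\dots\rangle=\langle1+\alpha_0,\dots\rangle$. Language: formulas are in negation normal form ($\neg$, $\to$ abbreviations). An operator form is a formula $\varphi(x,X)$ of arithmetic with an extra unary predicate $X$, with one free number variable and no subformula $\neg Xt$. $\mathcal L^\Omega_{\mathsf{ID}}$ extends $\mathcal L_{\mathsf{PA}}$ by predicates $I^{\prec\alpha}_\varphi$ for each operator form $\varphi$ and term $\alpha\preceq\Omega$; $\varphi(t,I^{\prec\gamma}_\varphi)$ replaces $x$ by $t$ and $Xs$ by $I^{\prec\gamma}_\varphi s$. Each sentence is assigned a disjunction or conjunction: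 a false $\mathcal L_{\mathsf{PA}}$-literal $\simeq$ empty disjunction; $I^{\prec\alpha}_\varphi t\simeq\bigvee_{\gamma\prec\alpha}\varphi(t,I^{\prec\gamma}_\varphi)$; $\psi_0\lor\psi_1\simeq\bigvee_{i\prec2}\psi_i$; $\exists x\,\psi(x)\simeq\bigvee_{n\prec\omega}\psi(n)$; and $\neg\psi\simeq\bigwedge_{\gamma\prec\alpha}\neg\psi_\gamma$ whenever $\psi\simeq\bigvee_{\gamma\prec\alpha}\psi_\gamma$. Ranks: $\operatorname{rk}=0$ for $\mathcal L_{\mathsf{PA}}$-literals, $\operatorname{rk}(\pm I^{\prec\alpha}_\varphi t)=\omega\cdot\alpha$, $\operatorname{rk}(\psi_0\lor\psi_1)=\operatorname{rk}(\psi_0\land\psi_1)=\max(\operatorname{rk}\psi_0,\operatorname{rk}\psi_1)+1$, $\operatorname{rk}(\exists x\psi)=\operatorname{rk}(\forall x\psi)=\operatorname{rk}(\psi)+1$. $k(\psi)$ is the set of $\alpha$ such that $\psi$ contains a literal $I^{\prec\alpha}_\varphi t$ or $\neg I^{\prec\alpha}_\varphi t$; for a sequent (finite set of sentences) $k(\Gamma)=\bigcup_{\psi\in\Gamma}k(\psi)$. Operators: with $\mathcal P$ the powerset of $\vartheta(\varepsilon_{\Omega+1})$, a nice operator is $\mathcal H:\mathcal P\to\mathcal P$ with $X\subseteq\mathcal H(X)$, ($X\subseteq\mathcal H(Y)\Rightarrow\mathcal H(X)\subseteq\mathcal H(Y)$), and ($\alpha\in\mathcal H(X)\Leftrightarrow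 E(\alpha)\subseteq\mathcal H(X)$); $\mathcal H[Z](X):=\mathcal H(Z\cup X)$. Derivations: $\mathcal H\vdash^\alpha_\rho\Gamma$ is defined by recursion on $\alpha$: it holds iff $\{\alpha\}\cup k(\Gamma)\subseteq\mathcal H(\emptyset)$ and one of: ($\bigwedge$) some $\psi\simeq\bigwedge_{\gamma\prec\delta}\psi_\gamma$ in $\Gamma$ such that for every $\gamma\prec\delta$ there is $\alpha(\gamma)\prec\alpha$ with $\mathcal H[\{\gamma\}]\vdash^{\alpha(\gamma)}_\rho\Gamma\cup\{\psi_\gamma\}$; ($\bigvee$) some $\psi\simeq\bigvee_{\gamma\prec\delta}\psi_\gamma$ in $\Gamma$, some $\gamma\prec\delta$ with $\gamma\prec\alpha$ and $\gamma\in\mathcal H(\emptyset)$, and $\alpha'\prec\alpha$ with $\mathcal H\vdash^{\alpha'}_\rho\Gamma\cup\{\psi_\gamma\}$; (Cut) some sentence $\psi$ with $\operatorname{rk}(\psi)\prec\rho$ and $\alpha'\prec\alpha$ with $\mathcal H\vdash^{\alpha'}_\rho\Gamma\cup\{\psi\}$ and $\mathcal H\vdash^{\alpha'}_\rho\Gamma\cup\{\neg\psi\}$; (Fix) $\Omega\preceq\alpha$, some $I^{\prec\Omega}_\varphi t\in\Gamma$ and $\alpha'\prec\alpha$ with $\mathcal H\vdash^{\alpha'}_\rho\Gamma\cup\{\varphi(t,I^{\prec\Omega}_\varphi)\}$. A single sentence $\psi$ is identified with the sequent $\{\psi\}$. -}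

module Defs where

open import Data.Bool using (Bool; true; false; _∧_; _∨_; not; if_then_else_; T)
open import Data.Nat using (ℕ; zero; suc; _≡ᵇ_)
open import Data.Fin using (Fin; zero; suc)
open import Data.List using (List; []; _∷_; _++_; take; replicate; map; length; concatMap)
open import Data.List.Membership.Propositional using (_∈_)
open import Data.List.Relation.Unary.All using (All)
open import Data.Product using (Σ; _×_; _,_)
open import Data.Sum using (_⊎_)
open import Data.Empty using (⊥)
open import Function using (_⇔_)
open import Relation.Binary.PropositionalEquality using (_≡_)

-- Ordinal terms (raw syntax); the notation system ϑ(ε_{Ω+1}) is the set
-- of raw terms t with WF t.

data Tm : Set where
  Ω   : Tm
  ϑ   : Tm → Tm
  ⟨_⟩ : List Tm → Tm

mutual
  eqTm : Tm → Tm → Bool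
  eqTm Ω Ω = true
  eqTm (ϑ a) (ϑ b) = eqTm a b
  eqTm ⟨ as ⟩ ⟨ bs ⟩ = eqL as bs
  eqTm _ _ = false

  eqL : List Tm → List Tm → Bool
  eqL [] [] = true
  eqL (a ∷ as) (b ∷ bs) = eqTm a b ∧ eqL as bs
  eqL _ _ = false

mutual
  E : Tm → List Tm
  E Ω = []
  E (ϑ a) = ϑ a ∷ []
  E ⟨ as ⟩ = EL as

  EL : List Tm → List Tm
  EL [] = []
  EL (a ∷ as) = E a ++ EL as

-- The relation ≺, as a (terminating) boolean recursion.
--   allE a β  =  "γ ≺ β for all γ ∈ E(a)"
--   anyE α b  =  "α ⪯ γ for some γ ∈ E(b)"
mutual
  lt : Tm → Tm → Bool
  lt Ω Ω = false
  lt Ω (ϑ _) = false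
  lt Ω ⟨ [] ⟩ = false
  lt Ω ⟨ b ∷ _ ⟩ = lt Ω b ∨ eqTm Ω b
  lt (ϑ a) Ω = true
  lt (ϑ a) ⟨ [] ⟩ = false
  lt (ϑ a) ⟨ b ∷ _ ⟩ = lt (ϑ a) b ∨ eqTm (ϑ a) b
  lt (ϑ a) (ϑ b) = (lt a b ∧ allE a (ϑ b)) ∨ anyE (ϑ a) b
  lt ⟨ [] ⟩ Ω = true
  lt ⟨ a ∷ _ ⟩ Ω = lt a Ω
  lt ⟨ [] ⟩ (ϑ b) = true
  lt ⟨ a ∷ _ ⟩ (ϑ b) = lt a (ϑ b)
  lt ⟨ as ⟩ ⟨ bs ⟩ = lexL as bs

  allE : Tm → Tm → Bool
  allE Ω β = true
  allE (ϑ a) β = lt (ϑ a) β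
  allE ⟨ as ⟩ β = allEL as β

  allEL : List Tm → Tm → Bool
  allEL [] β = true
  allEL (a ∷ as) β = allE a β ∧ allEL as β

  anyE : Tm → Tm → Bool
  anyE α Ω = false
  anyE α (ϑ b) = lt α (ϑ b) ∨ eqTm α (ϑ b)
  anyE α ⟨ bs ⟩ = anyEL α bs

  anyEL : Tm → List Tm → Bool
  anyEL α [] = false
  anyEL α (b ∷ bs) = anyE α b ∨ anyEL α bs

  lexL : List Tm → List Tm → Bool
  lexL [] [] = false
  lexL [] (_ ∷ _) = true
  lexL (_ ∷ _) [] = false
  lexL (a ∷ as) (b ∷ bs) = if eqTm a b then lexL as bs else lt a b

le : Tm → Tm → Bool
le a b = lt a b ∨ eqTm a b

_≺_ : Tm → Tm → Set
a ≺ b = T (lt a b)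

_⪯_ : Tm → Tm → Set
a ⪯ b = T (le a b)

infix 4 _≺_ _⪯_

isΩϑ : Tm → Bool
isΩϑ Ω = true
isΩϑ (ϑ _) = true
isΩϑ ⟨ _ ⟩ = false

desc : List Tm → Bool
desc (a ∷ b ∷ r) = le b a ∧ desc (b ∷ r)
desc _ = true

shapeOK : List Tm → Bool
shapeOK [] = true
shapeOK (a ∷ []) = not (isΩϑ a)
shapeOK (a ∷ b ∷ r) = desc (a ∷ b ∷ r)

mutual
  wf : Tm → Bool
  wf Ω = true
  wf (ϑ a) = wf a
  wf ⟨ as ⟩ = wfL as ∧ shapeOK as

  wfL : List Tm → Bool
  wfL [] = true
  wfL (a ∷ as) = wf a ∧ wfL as

WF : Tm → Set
WF t = T (wf t)

numT : ℕ → Tm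
numT n = ⟨ replicate n ⟨ [] ⟩ ⟩

ωT : Tm
ωT = ⟨ numT 1 ∷ [] ⟩

-- addition (Ω, ϑα identified with ⟨Ω⟩, ⟨ϑα⟩)
toL : Tm → List Tm
toL Ω = Ω ∷ []
toL (ϑ a) = ϑ a ∷ []
toL ⟨ as ⟩ = as

fromL : List Tm → Tm
fromL (Ω ∷ []) = Ω
fromL (ϑ a ∷ []) = ϑ a
fromL xs = ⟨ xs ⟩

-- largest k such that b ⪯ a_{k-1} (0 if none)
largestK : Tm → List Tm → ℕ
largestK b [] = 0
largestK b (a ∷ as) with largestK b as
... | suc r = suc (suc r)
... | zero = if le b a then 1 else 0

plusL : List Tm → List Tm → Tm
plusL as [] = fromL as
plusL as (b ∷ bs) = fromL (take (largestK b as) as ++ (b ∷ bs))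

_+T_ : Tm → Tm → Tm
a +T b = plusL (toL a) (toL b)

ω·_ : Tm → Tm
ω· Ω = Ω
ω· (ϑ a) = ϑ a
ω· ⟨ as ⟩ = ⟨ map (numT 1 +T_) as ⟩

maxT : Tm → Tm → Tm
maxT a b = if lt a b then b else a

data Term (n : ℕ) : Set where
  var  : Fin n → Term n
  zer  : Term n
  sc   : Term n → Term n
  _⊕_  : Term n → Term n → Term n
  _⊗_  : Term n → Term n → Term n

renT : ∀ {m n} → (Fin m → Fin n) → Term m → Term n
renT r (var i) = var (r i)
renT r zer = zer
renT r (sc t) = sc (renT r t)
renT r (s ⊕ t) = renT r s ⊕ renT r t
renT r (s ⊗ t) = renT r s ⊗ renT r t

subT : ∀ {m n} → (Fin m → Term n) → Term m → Term n
subT σ (var i) = σ i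
subT σ zer = zer
subT σ (sc t) = sc (subT σ t)
subT σ (s ⊕ t) = subT σ s ⊕ subT σ t
subT σ (s ⊗ t) = subT σ s ⊗ subT σ t

exts : ∀ {m n} → (Fin m → Term n) → Fin (suc m) → Term (suc n)
exts σ zero = var zero
exts σ (suc i) = renT suc (σ i)

val : Term 0 → ℕ
val (var ())
val zer = 0
val (sc t) = suc (val t)
val (s ⊕ t) = val s Data.Nat.+ val t
val (s ⊗ t) = val s Data.Nat.* val t

numeral : ℕ → Term 0
numeral zero = zer
numeral (suc n) = sc (numeral n)

-- Formulas of arithmetic with an extra unary predicate X, in negation
-- normal form and without negative occurrences ¬Xt.
-- An operator form is such a formula with (at most) one free variable x.

data AF (n : ℕ) : Set where
  eqA neqA : Term n → Term n → AF n
  XA       : Term n → AF n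
  orA andA : AF n → AF n → AF n
  exA allA : AF (suc n) → AF n

OpForm : Set
OpForm = AF 1

-- Formulas of L^Ω_ID (negation normal form).  The index α of I^{≺α}_φ is
-- a raw term; membership in the language (α well formed, α ⪯ Ω) is the
-- predicate InL below.
data Fm (n : ℕ) : Set where
  eq neq  : Term n → Term n → Fm n
  I nI    : Tm → OpForm → Term n → Fm n
  or and  : Fm n → Fm n → Fm n
  ex all  : Fm (suc n) → Fm n

Sentence : Set
Sentence = Fm 0

neg : ∀ {n} → Fm n → Fm n
neg (eq s t) = neq s t
neg (neq s t) = eq s t
neg (I α φ t) = nI α φ t
neg (nI α φ t) = I α φ t
neg (or a b) = and (neg a) (neg b)
neg (and a b) = or (neg a) (neg b)
neg (ex a) = all (neg a)
neg (all a) = ex (neg a)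

subF : ∀ {m n} → (Fin m → Term n) → Fm m → Fm n
subF σ (eq s t) = eq (subT σ s) (subT σ t)
subF σ (neq s t) = neq (subT σ s) (subT σ t)
subF σ (I α φ t) = I α φ (subT σ t)
subF σ (nI α φ t) = nI α φ (subT σ t)
subF σ (or a b) = or (subF σ a) (subF σ b)
subF σ (and a b) = and (subF σ a) (subF σ b)
subF σ (ex a) = ex (subF (exts σ) a)
subF σ (all a) = all (subF (exts σ) a)

inst : ∀ {m n} → Tm → OpForm → (Fin m → Term n) → AF m → Fm n
inst γ φ σ (eqA s t) = eq (subT σ s) (subT σ t)
inst γ φ σ (neqA s t) = neq (subT σ s) (subT σ t)
inst γ φ σ (XA s) = I γ φ (subT σ s)
inst γ φ σ (orA a b) = or (inst γ φ σ a) (inst γ φ σ b)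
inst γ φ σ (andA a b) = and (inst γ φ σ a) (inst γ φ σ b)
inst γ φ σ (exA a) = ex (inst γ φ (exts σ) a)
inst γ φ σ (allA a) = all (inst γ φ (exts σ) a)

_[_,I≺_] : OpForm → Term 0 → Tm → Sentence
φ [ t ,I≺ γ ] = inst γ φ (λ _ → t) φ

k : ∀ {n} → Fm n → List Tm
k (eq _ _) = []
k (neq _ _) = []
k (I α _ _) = α ∷ []
k (nI α _ _) = α ∷ []
k (or a b) = k a ++ k b
k (and a b) = k a ++ k b
k (ex a) = k a
k (all a) = k a

InL : ∀ {n} → Fm n → Set
InL ψ = All (λ α → WF α × α ⪯ Ω) (k ψ)

rk : ∀ {n} → Fm n → Tm
rk (eq _ _) = numT 0
rk (neq _ _) = numT 0
rk (I α _ _) = ω· α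
rk (nI α _ _) = ω· α
rk (or a b) = maxT (rk a) (rk b) +T numT 1
rk (and a b) = maxT (rk a) (rk b) +T numT 1
rk (ex a) = rk a +T numT 1
rk (all a) = rk a +T numT 1

-- Assignment of disjunctions / conjunctions to sentences.
-- ψ ≃ ⋁_{γ≺idx ψ} comp ψ γ  if kind ψ ≡ disj,
-- ψ ≃ ⋀_{γ≺idx ψ} comp ψ γ  if kind ψ ≡ conj.

data Kind : Set where
  disj conj : Kind

kind : Sentence → Kind
kind (eq s t) = if val s ≡ᵇ val t then conj else disj   -- false literal: disj
kind (neq s t) = if val s ≡ᵇ val t then disj else conj
kind (I _ _ _) = disj
kind (nI _ _ _) = conj
kind (or _ _) = disj
kind (and _ _) = conj
kind (ex _) = disj
kind (all _) = conj

dIdx : Sentence → Tm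
dIdx (I α _ _) = α
dIdx (or _ _) = numT 2
dIdx (ex _) = ωT
dIdx _ = numT 0          -- false literals: empty disjunction

lenT : Tm → ℕ
lenT ⟨ as ⟩ = length as
lenT _ = 0

dComp : Sentence → Tm → Sentence
dComp (I α φ t) γ = φ [ t ,I≺ γ ]
dComp (or a b) ⟨ [] ⟩ = a
dComp (or a b) _ = b
dComp (ex a) γ = subF (λ _ → numeral (lenT γ)) a   -- γ = n ≺ ω
dComp ψ γ = ψ                      -- empty disjunction (irrelevant)

-- conjunctive sentences: ¬ψ ≃ ⋀_{γ≺α} ¬ψ_γ when ψ ≃ ⋁_{γ≺α} ψ_γ
idx : Sentence → Tm
idx ψ with kind ψ
... | disj = dIdx ψ
... | conj = dIdx (neg ψ)

comp : Sentence → Tm → Sentence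
comp ψ γ with kind ψ
... | disj = dComp ψ γ
... | conj = neg (dComp (neg ψ) γ)

Pred : Set₁
Pred = Tm → Set

Op : Set₁
Op = Pred → Pred

∅ : Pred
∅ _ = ⊥

_⊆_ : Pred → Pred → Set
X ⊆ Y = ∀ α → WF α → X α → Y α

record Nice (H : Op) : Set₁ where
  field
    incl  : ∀ X → X ⊆ H X
    close : ∀ X Y → X ⊆ H Y → H X ⊆ H Y
    ecomp : ∀ X α → WF α → (H X α ⇔ All (H X) (E α))

-- H[Z](X) := H(Z ∪ X), here Z = {γ}
_[_] : Op → Tm → Op
(H [ γ ]) X = H (λ x → x ≡ γ ⊎ X x)

-- Derivations  H ⊢^α_ρ Γ   (sequents as lists; Γ ∪ {ψ} is ψ ∷ Γ)

Sequent : Set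
Sequent = List Sentence

Side : Op → Tm → Sequent → Set
Side H α Γ = H ∅ α × (∀ {ψ} → ψ ∈ Γ → All (H ∅) (k ψ))

data _⊢^_⟨_⟩_ : Op → Tm → Tm → Sequent → Set₁ where
  ⋀-rule : ∀ {H α ρ Γ} → Side H α Γ → (ψ : Sentence) → ψ ∈ Γ → kind ψ ≡ conj →
    (∀ γ → WF γ → γ ≺ idx ψ →
       Σ Tm λ β → WF β × β ≺ α × ((H [ γ ]) ⊢^ β ⟨ ρ ⟩ (comp ψ γ ∷ Γ))) →
    H ⊢^ α ⟨ ρ ⟩ Γ
  ⋁-rule : ∀ {H α ρ Γ} → Side H α Γ → (ψ : Sentence) → ψ ∈ Γ → kind ψ ≡ disj →
    (γ : Tm) → WF γ → γ ≺ idx ψ → γ ≺ α → H ∅ γ →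
    (β : Tm) → WF β → β ≺ α → H ⊢^ β ⟨ ρ ⟩ (comp ψ γ ∷ Γ) →
    H ⊢^ α ⟨ ρ ⟩ Γ
  cut : ∀ {H α ρ Γ} → Side H α Γ → (ψ : Sentence) → InL ψ → rk ψ ≺ ρ →
    (β : Tm) → WF β → β ≺ α →
    H ⊢^ β ⟨ ρ ⟩ (ψ ∷ Γ) → H ⊢^ β ⟨ ρ ⟩ (neg ψ ∷ Γ) →
    H ⊢^ α ⟨ ρ ⟩ Γ
  fix : ∀ {H α ρ Γ} → Side H α Γ → Ω ⪯ α → (φ : OpForm) (t : Term 0) →
    I Ω φ t ∈ Γ →
    (β : Tm) → WF β → β ≺ α → H ⊢^ β ⟨ ρ ⟩ ((φ [ t ,I≺ Ω ]) ∷ Γ) →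
    H ⊢^ α ⟨ ρ ⟩ Γ

closure : OpForm → Sentence
closure φ = all (or (neg (inst Ω φ (λ _ → var zero) φ)) (I Ω φ (var zero)))

{-# OPTIONS --safe #-}

-- The closure axiom is derived in four inferences from the tautology
-- φ(n, I^{≺Ω}), ¬φ(n, I^{≺Ω}): the ⋀-rule for ∀x, the ⋁-rule for both
-- disjuncts, and Fix, which turns I^{≺Ω} n into φ(n, I^{≺Ω}).
-- A tautology ψ, ¬ψ all of whose literals live at one level δ ⪯ Ω is
-- derivable without cuts in height ℓ_δ(2·depth ψ + 1), by induction on ψ
-- and, for the pair I^{≺δ} t, ¬I^{≺δ} t, on δ: one ⋀-inference followed
-- by one ⋁-inference reduces it to the tautology φ(t, I^{≺γ}) at a level
-- γ ≺ δ.  The induction on δ needs ≺ to be well founded below Ω, which is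
-- the usual accessibility argument for ϑ-terms: accessibility is closed
-- under Cantor normal forms (compared lexicographically), and ϑα is
-- accessible once α is accessible among the terms whose ϑ-subterms are.

module Submission where

open import Defs
open import Data.Bool using (true; false; _∧_; _∨_; if_then_else_; T)
open import Data.Empty using (⊥; ⊥-elim)
open import Data.Fin using (Fin; zero; suc)
open import Data.List using (List; []; _∷_; _++_; replicate)
open import Data.List.Membership.Propositional using (_∈_)
open import Data.List.Membership.Propositional.Properties using (∈-++⁺ˡ; ∈-++⁺ʳ)
open import Data.List.Relation.Unary.All as All using (All; []; _∷_; lookup)
open import Data.List.Relation.Unary.All.Properties using (++⁺; ++⁻; ++⁻ˡ; ++⁻ʳ)
open import Data.List.Relation.Unary.Any using (here; there)
open import Data.List.Properties using (++-identityʳ)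
open import Data.Nat using (ℕ; zero; suc; _+_; _⊔_; _≤_; z≤n; s≤s; _≡ᵇ_)
open import Data.Nat.Properties using (≤-refl; ≤-reflexive; m⊔n≤o⇒m≤o; m⊔n≤o⇒n≤o; +-suc)
open import Data.Product using (Σ; _×_; _,_; proj₁; proj₂)
open import Data.Sum using (_⊎_; inj₁; inj₂)
open import Data.Unit using (⊤; tt)
open import Function.Bundles using (Equivalence)
open import Induction.WellFounded using (Acc; acc; acc⇒asym; module Subrelation)
open import Relation.Binary.PropositionalEquality using (_≡_; refl; sym; trans; cong; cong₂; subst)

T-∨⁻ : ∀ x {y} → T (x ∨ y) → T x ⊎ T y
T-∨⁻ true _ = inj₁ tt
T-∨⁻ false p = inj₂ p

T-∨⁺ˡ : ∀ x {y} → T x → T (x ∨ y)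
T-∨⁺ˡ true _ = tt

T-∨⁺ʳ : ∀ x {y} → T y → T (x ∨ y)
T-∨⁺ʳ true _ = tt
T-∨⁺ʳ false p = p

T-∧⁻ : ∀ x {y} → T (x ∧ y) → T x × T y
T-∧⁻ true p = tt , p

T-∧⁺ : ∀ {x y} → T x → T y → T (x ∧ y)
T-∧⁺ {true} _ q = q

T-if⁻ : ∀ b {x y} → T (if b then x else y) → (T b × T x) ⊎ T y
T-if⁻ true p = inj₁ (tt , p)
T-if⁻ false p = inj₂ p

T-if-false⁺ : ∀ b {x y} → b ≡ false → T y → T (if b then x else y)
T-if-false⁺ false refl p = p

≡false⇒¬T : ∀ {b} → b ≡ false → T b → ⊥
≡false⇒¬T refl ()

mutual
  eqTm⇒≡ : ∀ a b → T (eqTm a b) → a ≡ b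
  eqTm⇒≡ Ω Ω _ = refl
  eqTm⇒≡ (ϑ a) (ϑ b) p = cong ϑ (eqTm⇒≡ a b p)
  eqTm⇒≡ ⟨ as ⟩ ⟨ bs ⟩ p = cong ⟨_⟩ (eqL⇒≡ as bs p)

  eqL⇒≡ : ∀ as bs → T (eqL as bs) → as ≡ bs
  eqL⇒≡ [] [] _ = refl
  eqL⇒≡ (a ∷ as) (b ∷ bs) p with T-∧⁻ (eqTm a b) p
  ... | p₁ , p₂ = cong₂ _∷_ (eqTm⇒≡ a b p₁) (eqL⇒≡ as bs p₂)

mutual
  eqTm-refl : ∀ a → eqTm a a ≡ true
  eqTm-refl Ω = refl
  eqTm-refl (ϑ a) = eqTm-refl a
  eqTm-refl ⟨ as ⟩ = eqL-refl as

  eqL-refl : ∀ as → eqL as as ≡ true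
  eqL-refl [] = refl
  eqL-refl (a ∷ as) rewrite eqTm-refl a = eqL-refl as

⪯-refl : ∀ a → a ⪯ a
⪯-refl a = T-∨⁺ʳ (lt a a) (subst T (sym (eqTm-refl a)) tt)

≺0-false : ∀ a → lt a ⟨ [] ⟩ ≡ false
≺0-false Ω = refl
≺0-false (ϑ _) = refl
≺0-false ⟨ [] ⟩ = refl
≺0-false ⟨ _ ∷ _ ⟩ = refl

0⪯ : ∀ a → ⟨ [] ⟩ ⪯ a
0⪯ Ω = tt
0⪯ (ϑ _) = tt
0⪯ ⟨ [] ⟩ = tt
0⪯ ⟨ _ ∷ _ ⟩ = tt

wfL⇒All : ∀ as → T (wfL as) → All WF as
wfL⇒All [] _ = []
wfL⇒All (a ∷ as) p with T-∧⁻ (wf a) p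
... | p₁ , p₂ = p₁ ∷ wfL⇒All as p₂

WF-⟨⟩⁻ : ∀ as → WF ⟨ as ⟩ → All WF as × T (desc as)
WF-⟨⟩⁻ as p with T-∧⁻ (wfL as) p
... | p₁ , p₂ = wfL⇒All as p₁ , shape⇒desc as p₂
  where
  shape⇒desc : ∀ as → T (shapeOK as) → T (desc as)
  shape⇒desc [] _ = tt
  shape⇒desc (_ ∷ []) _ = tt
  shape⇒desc (_ ∷ _ ∷ _) p = p

WF-head : ∀ a as → WF ⟨ a ∷ as ⟩ → WF a
WF-head a as w = proj₁ (T-∧⁻ (wf a) (proj₁ (T-∧⁻ (wfL (a ∷ as)) w)))

desc-tail : ∀ a as → T (desc (a ∷ as)) → T (desc as)
desc-tail a [] _ = tt
desc-tail a (b ∷ r) p = proj₂ (T-∧⁻ (le b a) p)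

HeadsBelow : Tm → List Tm → Set
HeadsBelow a [] = ⊤
HeadsBelow a (b ∷ _) = b ⪯ a

desc-head : ∀ a as → T (desc (a ∷ as)) → HeadsBelow a as
desc-head a [] _ = tt
desc-head a (b ∷ r) p = proj₁ (T-∧⁻ (le b a) p)

EL⁻ : ∀ {P : Tm → Set} bs → All P (EL bs) → All (λ b → All P (E b)) bs
EL⁻ [] _ = []
EL⁻ (b ∷ bs) p with ++⁻ (E b) p
... | p₁ , p₂ = p₁ ∷ EL⁻ bs p₂

anyE-sound : ∀ a β → T (anyE a β) → Σ Tm λ γ → γ ∈ E β × a ⪯ γ
anyE-sound a Ω ()
anyE-sound a (ϑ b) p = ϑ b , here refl , p
anyE-sound a ⟨ bs ⟩ p = anyEL-sound bs p
  where
  anyEL-sound : ∀ bs → T (anyEL a bs) → Σ Tm λ γ → γ ∈ EL bs × a ⪯ γ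
  anyEL-sound [] ()
  anyEL-sound (b ∷ bs) p with T-∨⁻ (anyE a b) p
  ... | inj₁ q with anyE-sound a b q
  ...   | γ , γ∈ , a⪯γ = γ , ∈-++⁺ˡ γ∈ , a⪯γ
  anyEL-sound (b ∷ bs) p | inj₂ q with anyEL-sound bs q
  ...   | γ , γ∈ , a⪯γ = γ , ∈-++⁺ʳ (E b) γ∈ , a⪯γ

Nice-[] : ∀ {H} → Nice H → ∀ γ → Nice (H [ γ ])
Nice-[] {H} nH γ = record
  { incl = λ Y α w y → Nice.incl nH (γ∪ Y) α w (inj₂ y)
  ; close = λ Y Z Y⊆ → Nice.close nH (γ∪ Y) (γ∪ Z) (γ∪-⊆ Y Z Y⊆)
  ; ecomp = λ Y → Nice.ecomp nH (γ∪ Y)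
  }
  where
  γ∪ : Pred → Pred
  γ∪ Y x = x ≡ γ ⊎ Y x

  γ∪-⊆ : ∀ Y Z → Y ⊆ (H [ γ ]) Z → γ∪ Y ⊆ H (γ∪ Z)
  γ∪-⊆ Y Z Y⊆ α w (inj₁ e) = Nice.incl nH (γ∪ Z) α w (inj₁ e)
  γ∪-⊆ Y Z Y⊆ α w (inj₂ y) = Y⊆ α w y

[]-mono : ∀ {G} → Nice G → ∀ γ α → WF α → G ∅ α → (G [ γ ]) ∅ α
[]-mono {G} nG γ = Nice.close nG ∅ (λ x → x ≡ γ ⊎ ∅ x) λ _ _ ()

[]-∋ : ∀ {G} → Nice G → ∀ γ → WF γ → (G [ γ ]) ∅ γ
[]-∋ {G} nG γ w = Nice.incl nG (λ x → x ≡ γ ⊎ ∅ x) γ w (inj₁ refl)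

∈-fromE : ∀ {G} → Nice G → ∀ α → WF α → All (G ∅) (E α) → G ∅ α
∈-fromE nG α w = Equivalence.from (Nice.ecomp nG ∅ α w)

∈-toE : ∀ {G} → Nice G → ∀ α → WF α → G ∅ α → All (G ∅) (E α)
∈-toE nG α w = Equivalence.to (Nice.ecomp nG ∅ α w)

∈-ϑ-free : ∀ {G} → Nice G → ∀ α → WF α → E α ≡ [] → G ∅ α
∈-ϑ-free nG α w e = ∈-fromE nG α w (subst (All _) (sym e) [])

-- Well-foundedness of ≺ below Ω

module Lexicographic (D : Tm → Set) (D-⟨⟩ : ∀ as → D ⟨ as ⟩ → All D as × T (desc as)) where

  _≺ᴰ_ : Tm → Tm → Set
  x ≺ᴰ y = D x × x ≺ y

  Accᴰ : Tm → Set
  Accᴰ = Acc _≺ᴰ_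

  Desc : List Tm → Set
  Desc l = All D l × T (desc l)

  _≺ᴸ_ : List Tm → List Tm → Set
  m ≺ᴸ l = Desc m × T (lexL m l)

  Accᴸ : List Tm → Set
  Accᴸ = Acc _≺ᴸ_

  Accᴰ-⪯ : ∀ {b x} → Accᴰ b → D x → x ⪯ b → Accᴰ x
  Accᴰ-⪯ {b} {x} (acc rs) dx p with T-∨⁻ (lt x b) p
  ... | inj₁ q = rs (dx , q)
  ... | inj₂ q rewrite eqTm⇒≡ x b q = acc rs

  desc-Accᴰ : ∀ b m → Accᴰ b → All D m → T (desc m) → HeadsBelow b m → All Accᴰ m
  desc-Accᴰ b [] _ _ _ _ = []
  desc-Accᴰ b (x ∷ m) ab (dx ∷ dm) ds hb =
    let ax = Accᴰ-⪯ ab dx hb in ax ∷ desc-Accᴰ x m ax dm (desc-tail x m ds) (desc-head x m ds)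

  lex-Accᴰ : ∀ m l → T (lexL m l) → Desc m → All Accᴰ l → All Accᴰ m
  lex-Accᴰ [] l _ _ _ = []
  lex-Accᴰ (b ∷ m) (a ∷ l) p (db ∷ dm , ds) (aa ∷ al) with eqTm b a in eq
  ... | true with eqTm⇒≡ b a (subst T (sym eq) tt)
  ...   | refl = aa ∷ lex-Accᴰ m l p (dm , desc-tail b m ds) al
  lex-Accᴰ (b ∷ m) (a ∷ l) p (db ∷ dm , ds) (acc rs ∷ al) | false =
    let ab = rs (db , p) in ab ∷ desc-Accᴰ b m ab dm (desc-tail b m ds) (desc-head b m ds)

  Accᴸ-[] : Accᴸ []
  Accᴸ-[] = acc λ { {[]} (_ , ()) ; {_ ∷ _} (_ , ()) }

  HeadIH : Tm → Set
  HeadIH a = ∀ b → D b → b ≺ a → ∀ l → Desc l → HeadsBelow b l → Accᴸ l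

  ∷-Accᴸ : ∀ a → HeadIH a → ∀ l → Accᴸ l → Desc (a ∷ l) → Accᴸ (a ∷ l)
  ∷-Accᴸ a ih l (acc rl) (da ∷ dl , ds) = acc λ {m} p → below m p
    where
    split : ∀ b m → T (if eqTm b a then lexL m l else lt b a) →
            (T (lexL m l) × b ≡ a) ⊎ b ≺ a
    split b m p with T-if⁻ (eqTm b a) p
    ... | inj₁ (e , q) = inj₁ (q , eqTm⇒≡ b a e)
    ... | inj₂ q = inj₂ q

    below : ∀ m → m ≺ᴸ (a ∷ l) → Accᴸ m
    below [] _ = Accᴸ-[]
    below (b ∷ m) ((db ∷ dm , dsm) , p) with split b m p
    ... | inj₁ (q , refl) = ∷-Accᴸ a ih m (rl ((dm , desc-tail b m dsm) , q)) (db ∷ dm , dsm)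
    ... | inj₂ q = ih b db q (b ∷ m) (db ∷ dm , dsm) (⪯-refl b)

  headed-Accᴸ : ∀ a → Accᴰ a → ∀ l → Desc l → HeadsBelow a l → Accᴸ l
  headed-Accᴸ a (acc rs) = go
    where
    ih : HeadIH a
    ih b db b≺a = headed-Accᴸ b (rs (db , b≺a))

    go : ∀ l → Desc l → HeadsBelow a l → Accᴸ l
    go [] _ _ = Accᴸ-[]
    go (h ∷ l) (dh ∷ dl , ds) hb with T-∨⁻ (lt h a) hb
    ... | inj₁ q = ih h dh q (h ∷ l) (dh ∷ dl , ds) (⪯-refl h)
    ... | inj₂ q with eqTm⇒≡ h a q
    ...   | refl = ∷-Accᴸ a ih l (go l (dl , desc-tail h l ds) (desc-head h l ds)) (dh ∷ dl , ds)

  Accᴸ⇒Accᴰ : ∀ l → Accᴸ l → D ⟨ l ⟩ → All Accᴰ l → Accᴰ ⟨ l ⟩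
  Accᴸ⇒Accᴰ l (acc rl) _ al = acc below
    where
    head-below : ∀ {x} l → All Accᴰ l → T (lt x ⟨ l ⟩) → D x →
                 (∀ m → x ≡ ⟨ m ⟩ → ⊥) → Accᴰ x
    head-below {Ω} (b ∷ _) (ab ∷ _) p dx _ = Accᴰ-⪯ ab dx p
    head-below {ϑ _} (b ∷ _) (ab ∷ _) p dx _ = Accᴰ-⪯ ab dx p
    head-below {⟨ m ⟩} _ _ _ _ notList = ⊥-elim (notList m refl)

    lt⇒lexL : ∀ m → T (lt ⟨ m ⟩ ⟨ l ⟩) → T (lexL m l)
    lt⇒lexL [] q = q
    lt⇒lexL (_ ∷ _) q = q

    below : ∀ {x} → x ≺ᴰ ⟨ l ⟩ → Accᴰ x
    below {Ω} (dx , p) = head-below l al p dx λ _ ()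
    below {ϑ _} (dx , p) = head-below l al p dx λ _ ()
    below {⟨ m ⟩} (dx , p) =
      let dm = D-⟨⟩ m dx; m≺l = lt⇒lexL m p in
      Accᴸ⇒Accᴰ m (rl (dm , m≺l)) dx (lex-Accᴰ m l m≺l dm al)

  ⟨⟩-Accᴰ : ∀ l → D ⟨ l ⟩ → All Accᴰ l → Accᴰ ⟨ l ⟩
  ⟨⟩-Accᴰ [] d al = Accᴸ⇒Accᴰ [] Accᴸ-[] d al
  ⟨⟩-Accᴰ (h ∷ l) d (ah ∷ al) =
    Accᴸ⇒Accᴰ (h ∷ l) (headed-Accᴸ h ah (h ∷ l) (D-⟨⟩ (h ∷ l) d) (⪯-refl h)) d (ah ∷ al)

module ≺ʷ = Lexicographic WF WF-⟨⟩⁻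

Accʷ : Tm → Set
Accʷ = ≺ʷ.Accᴰ

AccE : Tm → Set
AccE a = WF a × All Accʷ (E a)

AccE-⟨⟩ : ∀ as → AccE ⟨ as ⟩ → All AccE as × T (desc as)
AccE-⟨⟩ as (w , e) with WF-⟨⟩⁻ as w
... | ws , ds = All.zip (ws , EL⁻ as e) , ds

module ≺ᴱ = Lexicographic AccE AccE-⟨⟩

Accʷ-0 : Accʷ ⟨ [] ⟩
Accʷ-0 = acc λ {x} (_ , p) → ⊥-elim (≡false⇒¬T (≺0-false x) p)

Accʷ-irrefl : ∀ {x} → Accʷ x → WF x → x ≺ x → ⊥
Accʷ-irrefl ax w p = acc⇒asym ax (w , p) (w , p)

Accʷ⇒Accᴱ : ∀ {x} → Accʷ x → ≺ᴱ.Accᴰ x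
Accʷ⇒Accᴱ = Subrelation.accessible λ (ax , p) → proj₁ ax , p

⟨∷⟩-Accʷ : ∀ h t → WF ⟨ h ∷ t ⟩ → Accʷ h → Accʷ ⟨ h ∷ t ⟩
⟨∷⟩-Accʷ h t w ah with WF-⟨⟩⁻ (h ∷ t) w
... | _ ∷ wt , ds = ≺ʷ.⟨⟩-Accᴰ (h ∷ t) w (ah ∷ ≺ʷ.desc-Accᴰ h t ah wt (desc-tail h t ds) (desc-head h t ds))

≺Ω-Accʷ : ∀ ε → AccE ε → ε ≺ Ω → Accʷ ε
≺Ω-Accʷ (ϑ _) (_ , aϑ ∷ []) _ = aϑ
≺Ω-Accʷ ⟨ [] ⟩ _ _ = Accʷ-0
≺Ω-Accʷ ⟨ h ∷ t ⟩ (w , e) p with WF-⟨⟩⁻ (h ∷ t) w | EL⁻ (h ∷ t) e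
... | wh ∷ _ , _ | eh ∷ _ = ⟨∷⟩-Accʷ h t w (≺Ω-Accʷ h (wh , eh) p)

mutual
  Accᴱ : ∀ a → AccE a → ≺ᴱ.Accᴰ a
  Accᴱ Ω _ = acc λ (ay , p) → Accʷ⇒Accᴱ (≺Ω-Accʷ _ ay p)
  Accᴱ (ϑ b) (_ , aϑ ∷ []) = Accʷ⇒Accᴱ aϑ
  Accᴱ ⟨ l ⟩ al = ≺ᴱ.⟨⟩-Accᴰ l al (All-Accᴱ l (proj₁ (AccE-⟨⟩ l al)))

  All-Accᴱ : ∀ l → All AccE l → All ≺ᴱ.Accᴰ l
  All-Accᴱ [] [] = []
  All-Accᴱ (x ∷ xs) (a ∷ as) = Accᴱ x a ∷ All-Accᴱ xs as

-- the two clauses of ϑβ ≺ ϑα: β ≺ α with E(β) ≺ ϑα (induction hypothesis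
-- on α), or ϑβ ⪯ γ for some γ ∈ E(α) (accessible by assumption)
ϑ-Accʷ : ∀ α → ≺ᴱ.Accᴰ α → AccE α → Accʷ (ϑ α)
ϑ-Accʷ α (acc rs) (_ , eα) = acc λ (w , p) → below _ w p
  where
  mutual
    below : ∀ ε → WF ε → ε ≺ ϑ α → Accʷ ε
    below (ϑ β) w p with T-∨⁻ (lt β α ∧ allE β (ϑ α)) p
    ... | inj₁ q with T-∧⁻ (lt β α) q
    ...   | β≺α , Eβ≺ϑα = let aβ = (w , below-E β w Eβ≺ϑα) in ϑ-Accʷ β (rs (aβ , β≺α)) aβ
    below (ϑ β) w p | inj₂ q with anyE-sound (ϑ β) α q
    ...   | γ , γ∈ , ϑβ⪯γ = ≺ʷ.Accᴰ-⪯ (lookup eα γ∈) w ϑβ⪯γ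
    below ⟨ [] ⟩ _ _ = Accʷ-0
    below ⟨ h ∷ t ⟩ w p = ⟨∷⟩-Accʷ h t w (below h (WF-head h t w) p)

    below-E : ∀ β → WF β → T (allE β (ϑ α)) → All Accʷ (E β)
    below-E Ω _ _ = []
    below-E (ϑ b) w p = below (ϑ b) w p ∷ []
    below-E ⟨ bs ⟩ w p = below-EL bs (proj₁ (WF-⟨⟩⁻ bs w)) p

    below-EL : ∀ bs → All WF bs → T (allEL bs (ϑ α)) → All Accʷ (EL bs)
    below-EL [] _ _ = []
    below-EL (b ∷ bs) (w ∷ ws) p with T-∧⁻ (allE b (ϑ α)) p
    ... | p₁ , p₂ = ++⁺ (below-E b w p₁) (below-EL bs ws p₂)

mutual
  WF⇒AccE : ∀ a → WF a → All Accʷ (E a)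
  WF⇒AccE Ω _ = []
  WF⇒AccE (ϑ b) w = ϑ-Accʷ b (Accᴱ b (w , WF⇒AccE b w)) (w , WF⇒AccE b w) ∷ []
  WF⇒AccE ⟨ bs ⟩ w = WF⇒AccEL bs (proj₁ (WF-⟨⟩⁻ bs w))

  WF⇒AccEL : ∀ bs → All WF bs → All Accʷ (EL bs)
  WF⇒AccEL [] _ = []
  WF⇒AccEL (b ∷ bs) (w ∷ ws) = ++⁺ (WF⇒AccE b w) (WF⇒AccEL bs ws)

≺Ω⇒Accʷ : ∀ ε → WF ε → ε ≺ Ω → Accʷ ε
≺Ω⇒Accʷ ε w = ≺Ω-Accʷ ε (w , WF⇒AccE ε w)

Accʷ-Ω : Accʷ Ω
Accʷ-Ω = acc λ (w , p) → ≺Ω⇒Accʷ _ w p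

-- Heights

⟨∷⟩≢ : ∀ a as → eqTm a ⟨ a ∷ as ⟩ ≡ false
⟨∷⟩≢ a as with eqTm a ⟨ a ∷ as ⟩ in eq
... | false = refl
... | true with eqTm⇒≡ a ⟨ a ∷ as ⟩ (subst T (sym eq) tt)
...   | ()

a≺⟨a∷as⟩ : ∀ a as → a ≺ ⟨ a ∷ as ⟩
a≺⟨a∷as⟩ Ω as = tt
a≺⟨a∷as⟩ (ϑ a) as = T-∨⁺ʳ (lt (ϑ a) (ϑ a)) (subst T (sym (eqTm-refl a)) tt)
a≺⟨a∷as⟩ ⟨ [] ⟩ as = tt
a≺⟨a∷as⟩ ⟨ b ∷ bs ⟩ as rewrite ⟨∷⟩≢ b bs = a≺⟨a∷as⟩ b bs

≺⇒≢ : ∀ {ε δ} → Accʷ δ → WF δ → ε ≺ δ → eqTm ε δ ≡ false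
≺⇒≢ {ε} {δ} aδ wδ p with eqTm ε δ in eq
... | false = refl
... | true with eqTm⇒≡ ε δ (subst T (sym eq) tt)
...   | refl = ⊥-elim (Accʷ-irrefl aδ wδ p)

mutual
  ≺⇒≺⟨∷⟩ : ∀ ε δ → WF ε → WF δ → δ ≺ Ω → ε ≺ δ → ∀ r → ε ≺ ⟨ δ ∷ r ⟩
  ≺⇒≺⟨∷⟩ Ω δ _ _ _ p r = T-∨⁺ˡ (lt Ω δ) p
  ≺⇒≺⟨∷⟩ (ϑ a) δ _ _ _ p r = T-∨⁺ˡ (lt (ϑ a) δ) p
  ≺⇒≺⟨∷⟩ ⟨ [] ⟩ δ _ _ _ p r = tt
  ≺⇒≺⟨∷⟩ ⟨ e ∷ es ⟩ δ wε wδ δ≺Ω p r =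
    let e≺δ = ⟨∷⟩≺⇒≺ e es δ (WF-head e es wε) wδ δ≺Ω p in
    T-if-false⁺ (eqTm e δ) (≺⇒≢ {e} (≺Ω⇒Accʷ δ wδ δ≺Ω) wδ e≺δ) e≺δ

  ⟨∷⟩≺⇒≺ : ∀ e es δ → WF e → WF δ → δ ≺ Ω → ⟨ e ∷ es ⟩ ≺ δ → e ≺ δ
  ⟨∷⟩≺⇒≺ e es (ϑ b) _ _ _ p = p
  ⟨∷⟩≺⇒≺ e es ⟨ d ∷ ds ⟩ we wδ δ≺Ω p with T-if⁻ (eqTm e d) p
  ... | inj₁ (e≡d , _) rewrite eqTm⇒≡ e d e≡d = a≺⟨a∷as⟩ d ds
  ... | inj₂ e≺d = ≺⇒≺⟨∷⟩ e d we (WF-head d ds wδ) δ≺Ω e≺d ds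

≺Ω⇒≺⟨Ω∷⟩ : ∀ ε → ε ≺ Ω → ∀ r → ε ≺ ⟨ Ω ∷ r ⟩
≺Ω⇒≺⟨Ω∷⟩ (ϑ _) _ r = tt
≺Ω⇒≺⟨Ω∷⟩ ⟨ [] ⟩ _ r = tt
≺Ω⇒≺⟨Ω∷⟩ ⟨ ϑ _ ∷ _ ⟩ _ r = tt
≺Ω⇒≺⟨Ω∷⟩ ⟨ ⟨ _ ⟩ ∷ _ ⟩ p r = p

≺-≺Ω-trans : ∀ ε δ → ε ≺ δ → δ ≺ Ω → ε ≺ Ω
≺-≺Ω-trans (ϑ _) δ _ _ = tt
≺-≺Ω-trans ⟨ [] ⟩ δ _ _ = tt
≺-≺Ω-trans Ω ⟨ d ∷ ds ⟩ p q with T-∨⁻ (lt Ω d) p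
... | inj₁ Ω≺d = ≺-≺Ω-trans Ω d Ω≺d q
... | inj₂ Ω≡d rewrite sym (eqTm⇒≡ Ω d Ω≡d) = q
≺-≺Ω-trans ⟨ e ∷ es ⟩ (ϑ b) p q = ≺-≺Ω-trans e (ϑ b) p tt
≺-≺Ω-trans ⟨ e ∷ es ⟩ ⟨ d ∷ ds ⟩ p q with T-if⁻ (eqTm e d) p
... | inj₁ (e≡d , _) rewrite eqTm⇒≡ e d e≡d = q
... | inj₂ e≺d = ≺-≺Ω-trans e d e≺d q

lexL-[] : ∀ as → T (lexL as []) → ⊥
lexL-[] [] ()

≺ω⇒≺⟨∷⟩ : ∀ a as → eqTm ⟨ [] ⟩ a ≡ false → ⟨ [] ⟩ ≺ a → ∀ γ → γ ≺ ωT → γ ≺ ⟨ a ∷ as ⟩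
≺ω⇒≺⟨∷⟩ a as 0≢a 0≺a ⟨ [] ⟩ _ = tt
≺ω⇒≺⟨∷⟩ a as 0≢a 0≺a ⟨ ⟨ [] ⟩ ∷ gs ⟩ _ rewrite 0≢a = 0≺a
≺ω⇒≺⟨∷⟩ a as 0≢a 0≺a ⟨ ⟨ h ∷ hs ⟩ ∷ gs ⟩ p with T-if⁻ (eqTm ⟨ h ∷ hs ⟩ (numT 1)) p
... | inj₁ (_ , gs≺[]) = ⊥-elim (lexL-[] gs gs≺[])
... | inj₂ p′ with T-if⁻ (eqTm h ⟨ [] ⟩) p′
...   | inj₁ (_ , hs≺[]) = ⊥-elim (lexL-[] hs hs≺[])
...   | inj₂ h≺0 = ⊥-elim (≡false⇒¬T (≺0-false h) h≺0)

zeros : ℕ → List Tm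
zeros k = replicate k ⟨ [] ⟩

-- height a m denotes ω^a + m + 1
height : Tm → ℕ → Tm
height a m = ⟨ a ∷ zeros (suc m) ⟩

ω^_+1 : Tm → Tm
ω^ δ +1 = ⟨ δ ∷ ⟨ [] ⟩ ∷ [] ⟩

-- the exponent ω^δ + 1 rather than δ keeps these heights above ω when δ = 0
heightAt : Tm → ℕ → Tm
heightAt δ = height (ω^ δ +1)

WF-ω^+1 : ∀ δ → WF δ → WF (ω^ δ +1)
WF-ω^+1 δ w = T-∧⁺ (T-∧⁺ w tt) (T-∧⁺ (0⪯ δ) tt)

WF-height : ∀ a → WF a → ∀ m → WF (height a m)
WF-height a w m = T-∧⁺ (T-∧⁺ w (wf-zeros (suc m))) (T-∧⁺ (0⪯ a) (desc-zeros (suc m)))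
  where
  wf-zeros : ∀ k → T (wfL (zeros k))
  wf-zeros zero = tt
  wf-zeros (suc k) = wf-zeros k

  desc-zeros : ∀ k → T (desc (zeros k))
  desc-zeros zero = tt
  desc-zeros (suc zero) = tt
  desc-zeros (suc (suc k)) = desc-zeros (suc k)

height-mono : ∀ a {m′ m} → suc m′ ≤ m → height a m′ ≺ height a m
height-mono a {m′} {m} m′<m rewrite eqTm-refl a = lex-zeros m′ m m′<m
  where
  lex-zeros : ∀ m′ m → suc m′ ≤ m → T (lexL (zeros m′) (zeros m))
  lex-zeros zero (suc m) _ = tt
  lex-zeros (suc m′) (suc m) (s≤s p) = lex-zeros m′ m p

E-height : ∀ a m → E (height a m) ≡ E a
E-height a m = trans (cong (E a ++_) (EL-zeros (suc m))) (++-identityʳ (E a))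
  where
  EL-zeros : ∀ k → EL (zeros k) ≡ []
  EL-zeros zero = refl
  EL-zeros (suc k) = EL-zeros k

height-∈ : ∀ {G} → Nice G → ∀ a → WF a → G ∅ a → ∀ m → G ∅ (height a m)
height-∈ nG a w a∈ m =
  ∈-fromE nG (height a m) (WF-height a w m) (subst (All _) (sym (E-height a m)) (∈-toE nG a w a∈))

record Heights (δ : Tm) (ℓ : ℕ → Tm) : Set₁ where
  field
    WF-ℓ : ∀ m → WF (ℓ m)
    ℓ-∈ : ∀ G → Nice G → G ∅ δ → ∀ m → G ∅ (ℓ m)
    ℓ-mono : ∀ {m′ m} → suc m′ ≤ m → ℓ m′ ≺ ℓ m
    ω≺ℓ : ∀ m γ → γ ≺ ωT → γ ≺ ℓ m
    δ≺ℓ : ∀ m ε → WF ε → ε ≺ δ → ε ≺ ℓ m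
    lower≺ℓ : ∀ m M ε → WF ε → ε ≺ δ → heightAt ε M ≺ ℓ m
    δ⪯Ω : ∀ ε → ε ≺ δ → ε ≺ Ω

heightsAt : ∀ δ → WF δ → δ ≺ Ω → Heights δ (heightAt δ)
heightsAt δ wδ δ≺Ω = record
  { WF-ℓ = WF-height (ω^ δ +1) wω
  ; ℓ-∈ = λ G nG δ∈ → height-∈ nG (ω^ δ +1) wω
             (∈-fromE nG (ω^ δ +1) wω (subst (All _) (sym (++-identityʳ (E δ))) (∈-toE nG δ wδ δ∈)))
  ; ℓ-mono = height-mono (ω^ δ +1)
  ; ω≺ℓ = λ m → ≺ω⇒≺⟨∷⟩ (ω^ δ +1) (zeros (suc m)) refl tt
  ; δ≺ℓ = λ m ε wε ε≺δ →
      ≺⇒≺⟨∷⟩ ε (ω^ δ +1) wε wω δ≺Ω (≺⇒≺⟨∷⟩ ε δ wε wδ δ≺Ω ε≺δ (⟨ [] ⟩ ∷ [])) (zeros (suc m))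
  ; lower≺ℓ = lower≺ℓ
  ; δ⪯Ω = λ ε ε≺δ → ≺-≺Ω-trans ε δ ε≺δ δ≺Ω
  }
  where
  wω : WF (ω^ δ +1)
  wω = WF-ω^+1 δ wδ

  lower≺ℓ : ∀ m M ε → WF ε → ε ≺ δ → heightAt ε M ≺ heightAt δ m
  lower≺ℓ m M ε wε ε≺δ rewrite ≺⇒≢ {ε} (≺Ω⇒Accʷ δ wδ δ≺Ω) wδ ε≺δ = ε≺δ

heightsΩ : Heights Ω (height Ω)
heightsΩ = record
  { WF-ℓ = WF-height Ω tt
  ; ℓ-∈ = λ G nG Ω∈ → height-∈ nG Ω tt Ω∈
  ; ℓ-mono = height-mono Ω
  ; ω≺ℓ = λ m → ≺ω⇒≺⟨∷⟩ Ω (zeros (suc m)) refl tt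
  ; δ≺ℓ = λ m ε _ ε≺Ω → ≺Ω⇒≺⟨Ω∷⟩ ε ε≺Ω (zeros (suc m))
  ; lower≺ℓ = λ _ _ _ _ ε≺Ω → ε≺Ω
  ; δ⪯Ω = λ _ ε≺Ω → ε≺Ω
  }

-- Formulas and sequents

depth : ∀ {n} → Fm n → ℕ
depth (eq _ _) = 0
depth (neq _ _) = 0
depth (I _ _ _) = 0
depth (nI _ _ _) = 0
depth (or a b) = suc (depth a ⊔ depth b)
depth (and a b) = suc (depth a ⊔ depth b)
depth (ex a) = suc (depth a)
depth (all a) = suc (depth a)

neg-involutive : ∀ {n} (ψ : Fm n) → neg (neg ψ) ≡ ψ
neg-involutive (eq s t) = refl
neg-involutive (neq s t) = refl
neg-involutive (I _ _ _) = refl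
neg-involutive (nI _ _ _) = refl
neg-involutive (or a b) = cong₂ or (neg-involutive a) (neg-involutive b)
neg-involutive (and a b) = cong₂ and (neg-involutive a) (neg-involutive b)
neg-involutive (ex a) = cong ex (neg-involutive a)
neg-involutive (all a) = cong all (neg-involutive a)

depth-neg : ∀ {n} (ψ : Fm n) → depth (neg ψ) ≡ depth ψ
depth-neg (eq s t) = refl
depth-neg (neq s t) = refl
depth-neg (I _ _ _) = refl
depth-neg (nI _ _ _) = refl
depth-neg (or a b) = cong₂ (λ x y → suc (x ⊔ y)) (depth-neg a) (depth-neg b)
depth-neg (and a b) = cong₂ (λ x y → suc (x ⊔ y)) (depth-neg a) (depth-neg b)
depth-neg (ex a) = cong suc (depth-neg a)
depth-neg (all a) = cong suc (depth-neg a)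

depth-subF : ∀ {m n} (σ : Fin m → Term n) (ψ : Fm m) → depth (subF σ ψ) ≡ depth ψ
depth-subF σ (eq s t) = refl
depth-subF σ (neq s t) = refl
depth-subF σ (I _ _ _) = refl
depth-subF σ (nI _ _ _) = refl
depth-subF σ (or a b) = cong₂ (λ x y → suc (x ⊔ y)) (depth-subF σ a) (depth-subF σ b)
depth-subF σ (and a b) = cong₂ (λ x y → suc (x ⊔ y)) (depth-subF σ a) (depth-subF σ b)
depth-subF σ (ex a) = cong suc (depth-subF (exts σ) a)
depth-subF σ (all a) = cong suc (depth-subF (exts σ) a)

k-neg : ∀ {n} (ψ : Fm n) → k (neg ψ) ≡ k ψ
k-neg (eq s t) = refl
k-neg (neq s t) = refl
k-neg (I _ _ _) = refl
k-neg (nI _ _ _) = refl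
k-neg (or a b) = cong₂ _++_ (k-neg a) (k-neg b)
k-neg (and a b) = cong₂ _++_ (k-neg a) (k-neg b)
k-neg (ex a) = k-neg a
k-neg (all a) = k-neg a

k-subF : ∀ {m n} (σ : Fin m → Term n) (ψ : Fm m) → k (subF σ ψ) ≡ k ψ
k-subF σ (eq s t) = refl
k-subF σ (neq s t) = refl
k-subF σ (I _ _ _) = refl
k-subF σ (nI _ _ _) = refl
k-subF σ (or a b) = cong₂ _++_ (k-subF σ a) (k-subF σ b)
k-subF σ (and a b) = cong₂ _++_ (k-subF σ a) (k-subF σ b)
k-subF σ (ex a) = k-subF (exts σ) a
k-subF σ (all a) = k-subF (exts σ) a

AtLevel : ∀ {n} → Tm → Fm n → Set
AtLevel δ ψ = All (_≡ δ) (k ψ)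

AtLevel-inst : ∀ {m n} γ φ (σ : Fin m → Term n) a → AtLevel γ (inst γ φ σ a)
AtLevel-inst γ φ σ (eqA s t) = []
AtLevel-inst γ φ σ (neqA s t) = []
AtLevel-inst γ φ σ (XA s) = refl ∷ []
AtLevel-inst γ φ σ (orA a b) = ++⁺ (AtLevel-inst γ φ σ a) (AtLevel-inst γ φ σ b)
AtLevel-inst γ φ σ (andA a b) = ++⁺ (AtLevel-inst γ φ σ a) (AtLevel-inst γ φ σ b)
AtLevel-inst γ φ σ (exA a) = AtLevel-inst γ φ (exts σ) a
AtLevel-inst γ φ σ (allA a) = AtLevel-inst γ φ (exts σ) a

AtLevel-neg : ∀ {n δ} (ψ : Fm n) → AtLevel δ ψ → AtLevel δ (neg ψ)
AtLevel-neg ψ = subst (All _) (sym (k-neg ψ))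

AtLevel-subF : ∀ {m n δ} (σ : Fin m → Term n) (ψ : Fm m) → AtLevel δ ψ → AtLevel δ (subF σ ψ)
AtLevel-subF σ ψ = subst (All _) (sym (k-subF σ ψ))

Controlled : Op → Sequent → Set
Controlled G Γ = ∀ {ψ} → ψ ∈ Γ → All (λ α → WF α × G ∅ α) (k ψ)

side : ∀ G {α Γ} → G ∅ α → Controlled G Γ → Side G α Γ
side G α∈ cΓ = α∈ , λ ψ∈ → All.map proj₂ (cΓ ψ∈)

Controlled-[] : ∀ {G Γ} → Nice G → ∀ γ → Controlled G Γ → Controlled (G [ γ ]) Γ
Controlled-[] nG γ cΓ ψ∈ = All.map (λ (w , α∈) → w , []-mono nG γ _ w α∈) (cΓ ψ∈)

Controlled-∷ : ∀ G {Γ δ ψ} → WF δ → G ∅ δ → AtLevel δ ψ → Controlled G Γ → Controlled G (ψ ∷ Γ)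
Controlled-∷ G {δ = δ} w δ∈ lψ cΓ (here refl) = All.map at-δ lψ
  where
  at-δ : ∀ {α} → α ≡ δ → WF α × G ∅ α
  at-δ refl = w , δ∈
Controlled-∷ G w δ∈ lψ cΓ (there ψ∈) = cΓ ψ∈

-- Tautologies

TautologiesOfDepth : Tm → Tm → ℕ → Set₁
TautologiesOfDepth δ α n =
  ∀ G → Nice G → G ∅ δ → ∀ ψ → depth ψ ≤ n → AtLevel δ ψ →
  ∀ Γ → ψ ∈ Γ → neg ψ ∈ Γ → Controlled G Γ → G ⊢^ α ⟨ numT 0 ⟩ Γ

TautologiesAt : Tm → (ℕ → Tm) → Set₁
TautologiesAt δ ℓ = ∀ n → TautologiesOfDepth δ (ℓ (suc (n + n))) n

⋀-empty : ∀ {G α ρ Γ} ψ → Side G α Γ → ψ ∈ Γ → kind ψ ≡ conj × idx ψ ≡ numT 0 → G ⊢^ α ⟨ ρ ⟩ Γ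
⋀-empty ψ sd ψ∈ (conj-ψ , idx≡0) =
  ⋀-rule sd ψ ψ∈ conj-ψ λ γ _ γ≺ → ⊥-elim (≡false⇒¬T (≺0-false γ) (subst (γ ≺_) idx≡0 γ≺))

true-eq : ∀ s t → (val s ≡ᵇ val t) ≡ true → kind (eq s t) ≡ conj × idx (eq s t) ≡ numT 0
true-eq s t e rewrite e = refl , refl

true-neq : ∀ s t → (val s ≡ᵇ val t) ≡ false → kind (neq s t) ≡ conj × idx (neq s t) ≡ numT 0
true-neq s t e rewrite e = refl , refl

⊢-equation : ∀ {G α ρ Γ} s t → Side G α Γ → eq s t ∈ Γ → neq s t ∈ Γ → G ⊢^ α ⟨ ρ ⟩ Γ
⊢-equation s t sd eq∈ neq∈ with val s ≡ᵇ val t in e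
... | true = ⋀-empty (eq s t) sd eq∈ (true-eq s t e)
... | false = ⋀-empty (neq s t) sd neq∈ (true-neq s t e)

-- The ⋁-premise chosen for the γ-th ⋀-premise of χ: a component of θ
-- whose negation is the γ-th component of χ.
record Matching (G : Op) (δ : Tm) (n : ℕ) (χ θ : Sentence) (γ : Tm) : Set where
  field
    γ′ : Tm
    WF-γ′ : WF γ′
    γ′≺idx : γ′ ≺ idx θ
    γ′≺ω : γ′ ≺ ωT
    γ′∈ : (G [ γ ]) ∅ γ′
    component : Sentence
    θ-component : comp θ γ′ ≡ component
    χ-component : comp χ γ ≡ neg component
    depth≤ : depth component ≤ n
    level : AtLevel δ component

match-∧∨ : ∀ {G δ n} → Nice G → ∀ x y a b → neg x ≡ a → neg y ≡ b →
           depth a ≤ n → depth b ≤ n → AtLevel δ a → AtLevel δ b →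
           ∀ γ → Matching G δ n (and x y) (or a b) γ
match-∧∨ {G} {δ} {n} nG x y _ _ refl refl da db la lb γ = by-shape γ
  where
  left : ∀ γ → comp (and x y) γ ≡ neg (neg x) → Matching G δ n (and x y) (or (neg x) (neg y)) γ
  left γ e = record
    { γ′ = numT 0 ; WF-γ′ = tt ; γ′≺idx = tt ; γ′≺ω = tt ; γ′∈ = ∈-ϑ-free (Nice-[] nG γ) (numT 0) tt refl
    ; component = neg x ; θ-component = refl ; χ-component = e ; depth≤ = da ; level = la }

  right : ∀ γ → comp (and x y) γ ≡ neg (neg y) → Matching G δ n (and x y) (or (neg x) (neg y)) γ
  right γ e = record
    { γ′ = numT 1 ; WF-γ′ = tt ; γ′≺idx = tt ; γ′≺ω = tt ; γ′∈ = ∈-ϑ-free (Nice-[] nG γ) (numT 1) tt refl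
    ; component = neg y ; θ-component = refl ; χ-component = e ; depth≤ = db ; level = lb }

  by-shape : ∀ γ → Matching G δ n (and x y) (or (neg x) (neg y)) γ
  by-shape ⟨ [] ⟩ = left ⟨ [] ⟩ refl
  by-shape Ω = right Ω refl
  by-shape (ϑ β) = right (ϑ β) refl
  by-shape ⟨ β ∷ βs ⟩ = right ⟨ β ∷ βs ⟩ refl

match-∀∃ : ∀ {G δ n} → Nice G → ∀ x a → neg x ≡ a → depth a ≤ n → AtLevel δ a →
           ∀ γ → WF γ → γ ≺ ωT → Matching G δ n (all x) (ex a) γ
match-∀∃ nG x _ refl d l γ w γ≺ω = record
  { γ′ = γ ; WF-γ′ = w ; γ′≺idx = γ≺ω ; γ′≺ω = γ≺ω ; γ′∈ = []-∋ nG γ w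
  ; component = subF σ (neg x) ; θ-component = refl ; χ-component = refl
  ; depth≤ = subst (_≤ _) (sym (depth-subF σ (neg x))) d ; level = AtLevel-subF σ (neg x) l }
  where
  σ : Fin 1 → Term 0
  σ _ = numeral (lenT γ)

LowerTautologies : Tm → Set₁
LowerTautologies δ = ∀ γ → WF γ → γ ≺ δ → TautologiesAt γ (heightAt γ)

module _ {δ : Tm} {ℓ : ℕ → Tm} (wδ : WF δ) (hs : Heights δ ℓ) where
  open Heights hs

  ⊢-literal : LowerTautologies δ → ∀ G → Nice G → G ∅ δ → ∀ {t} → 1 ≤ t →
              ∀ Γ → Controlled G Γ → ∀ φ u → I δ φ u ∈ Γ → nI δ φ u ∈ Γ → G ⊢^ ℓ t ⟨ numT 0 ⟩ Γ
  ⊢-literal lower G nG δ∈ {t} 1≤t Γ cΓ φ u I∈ nI∈ =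
    ⋀-rule (side G (ℓ-∈ G nG δ∈ t) cΓ) (nI δ φ u) nI∈ refl
      λ γ wγ γ≺δ → ℓ 0 , WF-ℓ 0 , ℓ-mono 1≤t , premise γ wγ γ≺δ
    where
    premise : ∀ γ → WF γ → γ ≺ δ → (G [ γ ]) ⊢^ ℓ 0 ⟨ numT 0 ⟩ (neg (φ [ u ,I≺ γ ]) ∷ Γ)
    premise γ wγ γ≺δ =
      ⋁-rule (side Gγ (ℓ-∈ Gγ nGγ ([]-mono nG γ δ wδ δ∈) 0) cΔ) (I δ φ u) (there I∈) refl
        γ wγ γ≺δ (δ≺ℓ 0 γ wγ γ≺δ) γ∈
        (heightAt γ (suc (N + N))) (WF-height (ω^ γ +1) (WF-ω^+1 γ wγ) (suc (N + N)))
        (lower≺ℓ 0 (suc (N + N)) γ wγ γ≺δ)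
        (lower γ wγ γ≺δ N Gγ nGγ γ∈ ψ ≤-refl lψ (ψ ∷ neg ψ ∷ Γ) (here refl) (there (here refl))
           (Controlled-∷ Gγ wγ γ∈ lψ cΔ))
      where
      ψ = φ [ u ,I≺ γ ]
      N = depth ψ
      Gγ = G [ γ ]
      nGγ = Nice-[] nG γ
      γ∈ = []-∋ nG γ wγ
      lψ : AtLevel γ ψ
      lψ = AtLevel-inst γ φ (λ _ → u) φ
      cΔ : Controlled Gγ (neg ψ ∷ Γ)
      cΔ = Controlled-∷ Gγ wγ γ∈ (AtLevel-neg ψ lψ) (Controlled-[] nG γ cΓ)

  ⊢-dual : ∀ {n b t} G → Nice G → G ∅ δ → ∀ Γ → Controlled G Γ → suc (suc b) ≤ t →
           ∀ χ θ → χ ∈ Γ → θ ∈ Γ → kind χ ≡ conj → kind θ ≡ disj →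
           (∀ γ → WF γ → γ ≺ idx χ → Matching G δ n χ θ γ) →
           TautologiesOfDepth δ (ℓ b) n → G ⊢^ ℓ t ⟨ numT 0 ⟩ Γ
  ⊢-dual {n} {b} {t} G nG δ∈ Γ cΓ b+1<t χ θ χ∈ θ∈ conj-χ disj-θ match taut =
    ⋀-rule (side G (ℓ-∈ G nG δ∈ t) cΓ) χ χ∈ conj-χ
      λ γ w γ≺ → ℓ (suc b) , WF-ℓ (suc b) , ℓ-mono b+1<t , premise γ (match γ w γ≺)
    where
    premise : ∀ γ → Matching G δ n χ θ γ → (G [ γ ]) ⊢^ ℓ (suc b) ⟨ numT 0 ⟩ (comp χ γ ∷ Γ)
    premise γ m =
      ⋁-rule (side Gγ (ℓ-∈ Gγ nGγ δ∈γ (suc b)) cΔ) θ (there θ∈) disj-θ γ′ WF-γ′ γ′≺idx (ω≺ℓ (suc b) γ′ γ′≺ω) γ′∈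
        (ℓ b) (WF-ℓ b) (ℓ-mono ≤-refl)
        (subst (λ c → Gγ ⊢^ ℓ b ⟨ numT 0 ⟩ (c ∷ comp χ γ ∷ Γ)) (sym θ-component)
          (taut Gγ nGγ δ∈γ component depth≤ level (component ∷ comp χ γ ∷ Γ)
             (here refl) (there (here (sym χ-component))) (Controlled-∷ Gγ wδ δ∈γ level cΔ)))
      where
      open Matching m
      Gγ = G [ γ ]
      nGγ = Nice-[] nG γ
      δ∈γ = []-mono nG γ δ wδ δ∈
      cΔ : Controlled Gγ (comp χ γ ∷ Γ)
      cΔ = Controlled-∷ Gγ wδ δ∈γ (subst (AtLevel δ) (sym χ-component) (AtLevel-neg component level))
             (Controlled-[] nG γ cΓ)

  tautologies-from : LowerTautologies δ → TautologiesAt δ ℓ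
  tautologies-from lower = taut
    where
    conclusion≤ : ∀ n → suc (suc (suc (n + n))) ≤ suc (suc n + suc n)
    conclusion≤ n = s≤s (s≤s (≤-reflexive (sym (+-suc n n))))

    taut : TautologiesAt δ ℓ
    taut n G nG δ∈ (eq s t) _ _ Γ ψ∈ ¬ψ∈ cΓ = ⊢-equation s t (side G (ℓ-∈ G nG δ∈ _) cΓ) ψ∈ ¬ψ∈
    taut n G nG δ∈ (neq s t) _ _ Γ ψ∈ ¬ψ∈ cΓ = ⊢-equation s t (side G (ℓ-∈ G nG δ∈ _) cΓ) ¬ψ∈ ψ∈
    taut n G nG δ∈ (I .δ φ u) _ (refl ∷ []) Γ ψ∈ ¬ψ∈ cΓ = ⊢-literal lower G nG δ∈ (s≤s z≤n) Γ cΓ φ u ψ∈ ¬ψ∈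
    taut n G nG δ∈ (nI .δ φ u) _ (refl ∷ []) Γ ψ∈ ¬ψ∈ cΓ = ⊢-literal lower G nG δ∈ (s≤s z≤n) Γ cΓ φ u ¬ψ∈ ψ∈
    taut (suc n) G nG δ∈ (or a b) (s≤s d) l Γ ψ∈ ¬ψ∈ cΓ =
      ⊢-dual G nG δ∈ Γ cΓ (conclusion≤ n) (and (neg a) (neg b)) (or a b) ¬ψ∈ ψ∈ refl refl
        (λ γ _ _ → match-∧∨ nG (neg a) (neg b) a b (neg-involutive a) (neg-involutive b)
                     (m⊔n≤o⇒m≤o _ _ d) (m⊔n≤o⇒n≤o _ _ d) (++⁻ˡ (k a) l) (++⁻ʳ (k a) l) γ)
        (taut n)
    taut (suc n) G nG δ∈ (and a b) (s≤s d) l Γ ψ∈ ¬ψ∈ cΓ =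
      ⊢-dual G nG δ∈ Γ cΓ (conclusion≤ n) (and a b) (or (neg a) (neg b)) ψ∈ ¬ψ∈ refl refl
        (λ γ _ _ → match-∧∨ nG a b (neg a) (neg b) refl refl
                     (subst (_≤ n) (sym (depth-neg a)) (m⊔n≤o⇒m≤o _ _ d))
                     (subst (_≤ n) (sym (depth-neg b)) (m⊔n≤o⇒n≤o _ _ d))
                     (AtLevel-neg a (++⁻ˡ (k a) l)) (AtLevel-neg b (++⁻ʳ (k a) l)) γ)
        (taut n)
    taut (suc n) G nG δ∈ (ex a) (s≤s d) l Γ ψ∈ ¬ψ∈ cΓ =
      ⊢-dual G nG δ∈ Γ cΓ (conclusion≤ n) (all (neg a)) (ex a) ¬ψ∈ ψ∈ refl refl
        (match-∀∃ nG (neg a) a (neg-involutive a) d l) (taut n)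
    taut (suc n) G nG δ∈ (all a) (s≤s d) l Γ ψ∈ ¬ψ∈ cΓ =
      ⊢-dual G nG δ∈ Γ cΓ (conclusion≤ n) (all a) (ex (neg a)) ψ∈ ¬ψ∈ refl refl
        (match-∀∃ nG a (neg a) refl (subst (_≤ n) (sym (depth-neg a)) d) (AtLevel-neg a l)) (taut n)

tautologies : ∀ δ ℓ → Accʷ δ → WF δ → Heights δ ℓ → TautologiesAt δ ℓ
tautologies δ ℓ (acc rs) wδ hs = tautologies-from wδ hs λ γ wγ γ≺δ →
  tautologies γ (heightAt γ) (rs (wγ , γ≺δ)) wγ (heightsAt γ wγ (Heights.δ⪯Ω hs γ γ≺δ))

-- The closure axiom

renT-subT : ∀ {m n p} (r : Fin n → Fin p) (σ : Fin m → Term n) t →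
            renT r (subT σ t) ≡ subT (λ i → renT r (σ i)) t
renT-subT r σ (var i) = refl
renT-subT r σ zer = refl
renT-subT r σ (sc t) = cong sc (renT-subT r σ t)
renT-subT r σ (s ⊕ t) = cong₂ _⊕_ (renT-subT r σ s) (renT-subT r σ t)
renT-subT r σ (s ⊗ t) = cong₂ _⊗_ (renT-subT r σ s) (renT-subT r σ t)

subT-renT : ∀ {m n p} (σ : Fin n → Term p) (r : Fin m → Fin n) t →
            subT σ (renT r t) ≡ subT (λ i → σ (r i)) t
subT-renT σ r (var i) = refl
subT-renT σ r zer = refl
subT-renT σ r (sc t) = cong sc (subT-renT σ r t)
subT-renT σ r (s ⊕ t) = cong₂ _⊕_ (subT-renT σ r s) (subT-renT σ r t)
subT-renT σ r (s ⊗ t) = cong₂ _⊗_ (subT-renT σ r s) (subT-renT σ r t)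

subT-subT : ∀ {m n p} (σ : Fin n → Term p) (τ : Fin m → Term n) t →
            subT σ (subT τ t) ≡ subT (λ i → subT σ (τ i)) t
subT-subT σ τ (var i) = refl
subT-subT σ τ zer = refl
subT-subT σ τ (sc t) = cong sc (subT-subT σ τ t)
subT-subT σ τ (s ⊕ t) = cong₂ _⊕_ (subT-subT σ τ s) (subT-subT σ τ t)
subT-subT σ τ (s ⊗ t) = cong₂ _⊗_ (subT-subT σ τ s) (subT-subT σ τ t)

subT-cong : ∀ {m n} {σ τ : Fin m → Term n} → (∀ i → σ i ≡ τ i) → ∀ t → subT σ t ≡ subT τ t
subT-cong e (var i) = e i
subT-cong e zer = refl
subT-cong e (sc t) = cong sc (subT-cong e t)
subT-cong e (s ⊕ t) = cong₂ _⊕_ (subT-cong e s) (subT-cong e t)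
subT-cong e (s ⊗ t) = cong₂ _⊗_ (subT-cong e s) (subT-cong e t)

exts-cong : ∀ {m n} {σ τ : Fin m → Term n} → (∀ i → σ i ≡ τ i) → ∀ i → exts σ i ≡ exts τ i
exts-cong e zero = refl
exts-cong e (suc i) = cong (renT suc) (e i)

exts-subT : ∀ {m n p} (σ : Fin n → Term p) (τ : Fin m → Term n) i →
            subT (exts σ) (exts τ i) ≡ exts (λ j → subT σ (τ j)) i
exts-subT σ τ zero = refl
exts-subT σ τ (suc i) = trans (subT-renT (exts σ) suc (τ i)) (sym (renT-subT suc σ (τ i)))

inst-cong : ∀ {m n} γ φ {σ τ : Fin m → Term n} → (∀ i → σ i ≡ τ i) → ∀ a → inst γ φ σ a ≡ inst γ φ τ a
inst-cong γ φ e (eqA s t) = cong₂ eq (subT-cong e s) (subT-cong e t)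
inst-cong γ φ e (neqA s t) = cong₂ neq (subT-cong e s) (subT-cong e t)
inst-cong γ φ e (XA s) = cong (I γ φ) (subT-cong e s)
inst-cong γ φ e (orA a b) = cong₂ or (inst-cong γ φ e a) (inst-cong γ φ e b)
inst-cong γ φ e (andA a b) = cong₂ and (inst-cong γ φ e a) (inst-cong γ φ e b)
inst-cong γ φ e (exA a) = cong ex (inst-cong γ φ (exts-cong e) a)
inst-cong γ φ e (allA a) = cong all (inst-cong γ φ (exts-cong e) a)

subF-inst : ∀ {m n p} γ φ (σ : Fin n → Term p) (τ : Fin m → Term n) a →
            subF σ (inst γ φ τ a) ≡ inst γ φ (λ i → subT σ (τ i)) a
subF-inst γ φ σ τ (eqA s t) = cong₂ eq (subT-subT σ τ s) (subT-subT σ τ t)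
subF-inst γ φ σ τ (neqA s t) = cong₂ neq (subT-subT σ τ s) (subT-subT σ τ t)
subF-inst γ φ σ τ (XA s) = cong (I γ φ) (subT-subT σ τ s)
subF-inst γ φ σ τ (orA a b) = cong₂ or (subF-inst γ φ σ τ a) (subF-inst γ φ σ τ b)
subF-inst γ φ σ τ (andA a b) = cong₂ and (subF-inst γ φ σ τ a) (subF-inst γ φ σ τ b)
subF-inst γ φ σ τ (exA a) =
  cong ex (trans (subF-inst γ φ (exts σ) (exts τ) a) (inst-cong γ φ (exts-subT σ τ) a))
subF-inst γ φ σ τ (allA a) =
  cong all (trans (subF-inst γ φ (exts σ) (exts τ) a) (inst-cong γ φ (exts-subT σ τ) a))

closureAt : OpForm → Term 0 → Sentence
closureAt φ u = or (neg (φ [ u ,I≺ Ω ])) (I Ω φ u)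

comp-closure : ∀ φ γ → comp (closure φ) γ ≡ closureAt φ (numeral (lenT γ))
comp-closure φ γ =
  cong (λ ψ → or (neg ψ) (I Ω φ u))
    (trans (cong (subF σ) (neg-involutive φ[x])) (subF-inst Ω φ σ (λ _ → var zero) φ))
  where
  u = numeral (lenT γ)
  σ : Fin 1 → Term 0
  σ _ = u
  φ[x] = inst Ω φ (λ _ → var zero) φ

AtLevel-closureAt : ∀ {n} φ (σ : Fin 1 → Term n) t → AtLevel Ω (or (neg (inst Ω φ σ φ)) (I Ω φ t))
AtLevel-closureAt φ σ t = ++⁺ (AtLevel-neg (inst Ω φ σ φ) (AtLevel-inst Ω φ σ φ)) (refl ∷ [])

closureSteps : OpForm → Term 0 → ℕ
closureSteps φ u = 3 + suc (depth (φ [ u ,I≺ Ω ]) + depth (φ [ u ,I≺ Ω ]))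

⊢-closureAt : ∀ {G} → Nice G → ∀ φ u Γ → Controlled G Γ → closureAt φ u ∈ Γ →
              G ⊢^ height Ω (closureSteps φ u) ⟨ numT 0 ⟩ Γ
⊢-closureAt {G} nG φ u Γ cΓ C∈ =
  ⋁-rule (side G (ℓ-∈ G nG Ω∈ (3 + K)) cΓ) (closureAt φ u) C∈ refl
    (numT 0) tt tt tt (∈-ϑ-free nG (numT 0) tt refl) (ℓ (2 + K)) (WF-ℓ (2 + K)) (ℓ-mono {2 + K} ≤-refl)
    (⋁-rule (side G (ℓ-∈ G nG Ω∈ (2 + K)) c¬P) (closureAt φ u) (there C∈) refl
      (numT 1) tt tt tt (∈-ϑ-free nG (numT 1) tt refl) (ℓ (1 + K)) (WF-ℓ (1 + K)) (ℓ-mono {1 + K} ≤-refl)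
      (fix (side G (ℓ-∈ G nG Ω∈ (1 + K)) cI) tt φ u (here refl) (ℓ K) (WF-ℓ K) (ℓ-mono {K} ≤-refl)
        (tautologies Ω ℓ Accʷ-Ω tt heightsΩ N G nG Ω∈ P ≤-refl lP
          (P ∷ I Ω φ u ∷ neg P ∷ Γ) (here refl) (there (there (here refl)))
          (Controlled-∷ G tt Ω∈ lP cI))))
  where
  ℓ = height Ω
  open Heights heightsΩ
  P = φ [ u ,I≺ Ω ]
  N = depth P
  K = suc (N + N)
  Ω∈ = ∈-ϑ-free nG Ω tt refl
  lP : AtLevel Ω P
  lP = AtLevel-inst Ω φ (λ _ → u) φ
  c¬P : Controlled G (neg P ∷ Γ)
  c¬P = Controlled-∷ G tt Ω∈ (AtLevel-neg P lP) cΓ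
  cI : Controlled G (I Ω φ u ∷ neg P ∷ Γ)
  cI = Controlled-∷ G tt Ω∈ (refl ∷ []) c¬P

proposition6p2 : (H : Op) → Nice H → (φ : OpForm) →
    Σ ℕ (λ n → H ⊢^ (Ω +T (ω· numT n)) ⟨ numT 0 ⟩ (closure φ ∷ []))
proposition6p2 H nH φ =
  1 , ⋀-rule (side H (∈-ϑ-free nH _ tt refl) (cΓ nH)) (closure φ) (here refl) refl
        λ γ _ _ → height Ω (closureSteps φ (u γ)) , WF-height Ω tt (closureSteps φ (u γ)) , tt , premise γ
  where
  u : Tm → Term 0
  u γ = numeral (lenT γ)

  cΓ : ∀ {G} → Nice G → Controlled G (closure φ ∷ [])
  cΓ {G} nG = Controlled-∷ G tt (∈-ϑ-free nG Ω tt refl) (AtLevel-closureAt φ (λ _ → var zero) (var zero)) (λ ())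

  premise : ∀ γ → (H [ γ ]) ⊢^ height Ω (closureSteps φ (u γ)) ⟨ numT 0 ⟩ (comp (closure φ) γ ∷ closure φ ∷ [])
  premise γ rewrite comp-closure φ γ =
    ⊢-closureAt nHγ φ (u γ) _
      (Controlled-∷ (H [ γ ]) tt (∈-ϑ-free nHγ Ω tt refl) (AtLevel-closureAt φ (λ _ → u γ) (u γ)) (cΓ nHγ))
      (here refl)
    where
    nHγ = Nice-[] nH γ
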